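{- Let $q=2^r\ge 16$. Then $\mathcal{S}_q=\{q/2-1\}$.
   Context: $\mathcal{T}_q$ is the set of functions $g:(\mathbb{Z}/q\mathbb{Z})^\times\to\{0,1\}$ such that $g(a)+g(-a)=1$ for all $a$, and $g(a)=0$ for every $a$ whose representative in $\{1,\dots,q-1\}$ is less than $q/3$. For $s\in(\mathbb{Z}/q\mathbb{Z})^\times$, $\theta_s$ denotes multiplication by $s$. $\mathcal{S}_q=\{s\in(\mathbb{Z}/q\mathbb{Z})^\times: s\ne 1\text{ and there exists } g\in\mathcal{T}_q \text{ with } g\circ\theta_s\in\mathcal{T}_q\}$. -}

module Defs where

open import Data.Nat using (ℕ; zero; suc; _+_; _*_; _∸_; _<_)
open import Relation.Binary.PropositionalEquality using (_≡_; _≢_)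
open import Data.Nat.DivMod using (_%_)
open import Data.Nat.Coprimality using (Coprime)
open import Data.Fin using (Fin; toℕ)
open import Data.Product using (_×_; ∃)

-- reduction mod q (q = 0 never occurs in our use; q ≥ 16)
_mod_ : ℕ → ℕ → ℕ
a mod zero = a
a mod suc n = a % suc n

-- Elements of (ℤ/qℤ)^× are represented by their representatives a ∈ {1,…,q-1}
-- with gcd(a,q)=1, i.e. a < q and Coprime a q (Coprime 0 q forces q = 1).
IsUnit : ℕ → ℕ → Set
IsUnit q a = a < q × Coprime a q

neg : ℕ → ℕ → ℕ
neg q a = (q ∸ a) mod q

θ : ℕ → ℕ → ℕ → ℕ
θ q s a = (s * a) mod q

-- g : (ℤ/qℤ)^× → {0,1}; values outside the units are irrelevant.
-- g ∈ 𝒯_q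
InT : (q : ℕ) → (ℕ → Fin 2) → Set
InT q g =
  (∀ a → IsUnit q a → toℕ (g a) + toℕ (g (neg q a)) ≡ 1) ×
  (∀ a → IsUnit q a → 3 * a < q → toℕ (g a) ≡ 0)

InS : ℕ → ℕ → Set
InS q s = IsUnit q s × s ≢ 1 × ∃ λ (g : ℕ → Fin 2) → InT q g × InT q (λ a → g (θ q s a))

{-# OPTIONS --safe #-}
-- Write q = 2^r = 4m; the units modulo q are the odd residues.  If g and g ∘ θ_s both lie in 𝒯_q,
-- then no unit a < q/3 can have x = s·a mod q > 2q/3: g ∘ θ_s ∈ 𝒯_q forces g(x) = 0, and g ∈ 𝒯_q
-- forces g(−x) = 0 because −x < q/3, against g(x) + g(−x) = 1.  Every odd s other than 1 and
-- q/2 − 1 has such an a, found by cases on the size of s: either a small constant (1, 3, 5 or 9)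
-- or the first odd multiple of a suitable step landing in a window that puts s·a mod q in
-- (2q/3, q).  Conversely s = q/2 − 1 acts on odd b as b ↦ q/2 − b, so θ_s preserves each half of
-- the odd residues, and the indicator of the upper half works as g.
module Submission where

open import Defs
open import Data.Nat
open import Data.Nat.Properties
open import Data.Nat.DivMod using ([m+kn]%n≡m%n; m<n⇒m%n≡m; m≡m%n+[m/n]*n; m%n<n; m*n/n≡m)
open import Data.Nat.Divisibility
  using (_∣_; divides; ∣-trans; ∣⇒≤; 0∣⇒≡0; ∣1⇒≡1; ∣m+n∣m⇒∣n; ∣m∣n⇒∣m+n; m∣m*n; n∣m*n)
open import Data.Nat.Coprimality using (Coprime; coprime-divisor)
open import Data.Nat.Tactic.RingSolver using (solve)
open import Data.List using (_∷_; [])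
open import Data.Product using (∃; _,_; _×_; proj₁)
open import Data.Sum using (_⊎_; inj₁; inj₂)
open import Data.Empty using (⊥; ⊥-elim)
open import Data.Fin using (Fin; zero; suc; toℕ)
open import Function.Bundles using (_⇔_; mk⇔)
open import Relation.Binary.Definitions using (tri<; tri≈; tri>)
open import Relation.Binary.PropositionalEquality
open import Relation.Nullary using (¬_; contradiction; yes; no)

Odd : ℕ → Set
Odd x = ∃ λ k → x ≡ 1 + 2 * k

odd⊎even : ∀ x → Odd x ⊎ 2 ∣ x
odd⊎even zero = inj₂ (divides 0 refl)
odd⊎even (suc x) with odd⊎even x
... | inj₁ (k , refl) = inj₂ (divides (suc k) (solve (k ∷ [])))
... | inj₂ (divides k refl) = inj₁ (k , cong suc (*-comm k 2))

odd⇒¬2∣ : ∀ {x} → Odd x → ¬ 2 ∣ x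
odd⇒¬2∣ (k , refl) 2∣x = contradiction (∣1⇒≡1 2∣1) λ ()
  where
  2∣1 : 2 ∣ 1
  2∣1 = ∣m+n∣m⇒∣n (subst (2 ∣_) (+-comm 1 (2 * k)) 2∣x) (m∣m*n k)

odd≢even : ∀ {x y} → Odd x → 2 ∣ y → x ≢ y
odd≢even ox 2∣y refl = odd⇒¬2∣ ox 2∣y

odd+2 : ∀ {x} → Odd x → Odd (x + 2)
odd+2 (k , refl) = suc k , solve (k ∷ [])

odd∧≢1⇒3≤ : ∀ {x} → Odd x → x ≢ 1 → 3 ≤ x
odd∧≢1⇒3≤ (zero  , refl) x≢1 = contradiction refl x≢1
odd∧≢1⇒3≤ (suc k , refl) _   = +-monoʳ-≤ 1 (*-monoʳ-≤ 2 (s≤s z≤n))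

odd+even⇒odd : ∀ {x e} → 2 ∣ e → Odd (x + e) → Odd x
odd+even⇒odd {x} 2∣e ox+e with odd⊎even x
... | inj₁ ox  = ox
... | inj₂ 2∣x = contradiction (∣m∣n⇒∣m+n 2∣x 2∣e) (odd⇒¬2∣ ox+e)

even-odd⇒odd : ∀ {x a n} → 2 ∣ n → Odd a → x + a ≡ n → Odd x
even-odd⇒odd {x} 2∣n oa x+a≡n with odd⊎even x
... | inj₁ ox  = ox
... | inj₂ 2∣x = contradiction (∣m+n∣m⇒∣n (subst (2 ∣_) (sym x+a≡n) 2∣n) 2∣x)
                              (odd⇒¬2∣ oa)

odd⇒0< : ∀ {x} → Odd x → 0 < x
odd⇒0< (_ , refl) = s≤s z≤n

odd*odd : ∀ {x y} → Odd x → Odd y → Odd (x * y)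
odd*odd (k , refl) (l , refl) = k + l + 2 * k * l , solve (k ∷ l ∷ [])

odd⇒coprime-2 : ∀ {x} → Odd x → Coprime x 2
odd⇒coprime-2 ox {zero} (_ , 0∣2) = contradiction (0∣⇒≡0 0∣2) λ ()
odd⇒coprime-2 ox {1} _ = refl
odd⇒coprime-2 ox {2} (2∣x , _) = contradiction 2∣x (odd⇒¬2∣ ox)
odd⇒coprime-2 ox {suc (suc (suc i))} (_ , i∣2) =
  contradiction (∣⇒≤ i∣2) λ { (s≤s (s≤s ())) }

odd⇒coprime-2^ : ∀ {x} → Odd x → ∀ r → Coprime x (2 ^ r)
odd⇒coprime-2^ ox zero (_ , i∣1) = ∣1⇒≡1 i∣1
odd⇒coprime-2^ ox (suc r) {i} (i∣x , i∣2^r+1) =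
  odd⇒coprime-2^ ox r (i∣x , coprime-divisor i⊥2 i∣2^r+1)
  where
  i⊥2 : Coprime i 2
  i⊥2 (j∣i , j∣2) = odd⇒coprime-2 ox (∣-trans j∣i i∣x , j∣2)

coprime-2*⇒odd : ∀ {x} n → Coprime x (2 * n) → Odd x
coprime-2*⇒odd {x} n x⊥2n with odd⊎even x
... | inj₁ ox = ox
... | inj₂ 2∣x = contradiction (x⊥2n (2∣x , m∣m*n n)) λ ()

mod≡% : ∀ y q .{{_ : NonZero q}} → y mod q ≡ y % q
mod≡% y (suc q) = refl

θ-≡ : ∀ {q s a} k {x} .{{_ : NonZero q}} → s * a ≡ k * q + x → x < q → θ q s a ≡ x
θ-≡ {q} {s} {a} k {x} s*a≡ x<q = begin
  θ q s a         ≡⟨ mod≡% (s * a) q ⟩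
  (s * a) % q     ≡⟨ cong (_% q) (trans s*a≡ (+-comm (k * q) x)) ⟩
  (x + k * q) % q ≡⟨ [m+kn]%n≡m%n x k q ⟩
  x % q           ≡⟨ m<n⇒m%n≡m x<q ⟩
  x               ∎
  where open ≡-Reasoning

neg-≡ : ∀ {q a} .{{_ : NonZero q}} → 0 < a → a ≤ q → neg q a ≡ q ∸ a
neg-≡ {q} {a} 0<a a≤q = trans (mod≡% (q ∸ a) q) (m<n⇒m%n≡m (∸-monoʳ-< 0<a a≤q))

neg-+ : ∀ {q a} .{{_ : NonZero q}} → 0 < a → a ≤ q → neg q a + a ≡ q
neg-+ {q} {a} 0<a a≤q = trans (cong (_+ a) (neg-≡ 0<a a≤q)) (m∸n+n≡m a≤q)

θ-+-multiple : ∀ q s a .{{_ : NonZero q}} → θ q s a + ((s * a) / q) * q ≡ s * a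
θ-+-multiple q s a =
  trans (cong (_+ (s * a / q) * q) (mod≡% (s * a) q)) (sym (m≡m%n+[m/n]*n (s * a) q))

complement-< : ∀ {x y h} → y + x ≡ h + h → x < h → h < y
complement-< {x} {y} {h} y+x≡h+h x<h = +-cancelʳ-< x h y (begin-strict
  h + x ≡⟨ +-comm h x ⟩
  x + h <⟨ +-monoˡ-< h x<h ⟩
  h + h ≡⟨ y+x≡h+h ⟨
  y + x ∎)
  where open ≤-Reasoning

complement-> : ∀ {x y h} → y + x ≡ h + h → h < x → y < h
complement-> {x} {y} {h} y+x≡h+h h<x = +-cancelʳ-< x y h (begin-strict
  y + x ≡⟨ y+x≡h+h ⟩
  h + h <⟨ +-monoʳ-< h h<x ⟩
  h + x ∎)
  where open ≤-Reasoning

complement-small : ∀ {x y q} → y + x ≡ q → 2 * q < 3 * x → 3 * y < q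
complement-small {x} {y} {q} y+x≡q 2q<3x = +-cancelʳ-< (2 * q) (3 * y) q (begin-strict
  3 * y + 2 * q ≡⟨ +-comm (3 * y) (2 * q) ⟩
  2 * q + 3 * y <⟨ +-monoˡ-< (3 * y) 2q<3x ⟩
  3 * x + 3 * y ≡⟨ solve (x ∷ y ∷ []) ⟩
  3 * (y + x)   ≡⟨ cong (3 *_) y+x≡q ⟩
  3 * q         ≡⟨ solve (q ∷ []) ⟩
  q + 2 * q     ∎)
  where open ≤-Reasoning

oddMultipleInWindow : ∀ d t → 1 ≤ d →
  ∃ λ k → t < d * (1 + 2 * k) × d * (1 + 2 * k) ≤ t + 2 * d
oddMultipleInWindow d zero 1≤d =
  0 , ≤-trans 1≤d (≤-reflexive (sym (*-identityʳ d))) ,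
  ≤-trans (≤-reflexive (*-identityʳ d)) (m≤n*m d 2)
oddMultipleInWindow d (suc t) 1≤d with oddMultipleInWindow d t 1≤d
... | k , t<dk , dk≤ with suc t <? d * (1 + 2 * k)
...   | yes t+1<dk = k , t+1<dk , ≤-trans dk≤ (+-monoˡ-≤ (2 * d) (n≤1+n t))
...   | no  t+1≮dk = suc k , subst (suc t <_) (sym next) (m<m+n (suc t) 0<2d) , ≤-reflexive next
  where
  next : d * (1 + 2 * suc k) ≡ suc t + 2 * d
  next = begin
    d * (1 + 2 * suc k)     ≡⟨ solve (d ∷ k ∷ []) ⟩
    d * (1 + 2 * k) + 2 * d ≡⟨ cong (_+ 2 * d) (≤-antisym (≮⇒≥ t+1≮dk) t<dk) ⟩
    suc t + 2 * d           ∎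
    where open ≡-Reasoning
  0<2d : 0 < 2 * d
  0<2d = ≤-trans 1≤d (m≤n*m d 2)

*-excess-≤ : ∀ {c e} x {y z} → c ≤ e → e * x ≤ y + e * z → c * x ≤ y + c * z
*-excess-≤ {c} {e} x {y} {z} c≤e ex≤ with ≤-total x z
... | inj₁ x≤z = ≤-trans (*-monoʳ-≤ c x≤z) (m≤n+m (c * z) y)
... | inj₂ z≤x with m≤n⇒∃[o]m+o≡n z≤x
...   | u , refl = begin
  c * (z + u)   ≡⟨ solve (c ∷ z ∷ u ∷ []) ⟩
  c * u + c * z ≤⟨ +-monoˡ-≤ (c * z) (≤-trans (*-monoˡ-≤ u c≤e) eu≤y) ⟩
  y + c * z     ∎
  where
  open ≤-Reasoning
  eu≤y : e * u ≤ y
  eu≤y = +-cancelʳ-≤ (e * z) (e * u) y (begin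
    e * u + e * z ≡⟨ solve (e ∷ z ∷ u ∷ []) ⟩
    e * (z + u)   ≤⟨ ex≤ ⟩
    y + e * z     ∎)

crossing⇒⊥ : ∀ {q s g a} → InT q g → InT q (λ b → g (θ q s b)) →
             IsUnit q a → 3 * a < q → IsUnit q (θ q s a) → IsUnit q (neg q (θ q s a)) →
             3 * neg q (θ q s a) < q → ⊥
crossing⇒⊥ {q} {s} {g} {a} (g-sum , g-small) (_ , gθ-small) ua 3a<q ux u-x 3[-x]<q =
  contradiction 1≡0 λ ()
  where
  open ≡-Reasoning
  x = θ q s a
  1≡0 : 1 ≡ 0
  1≡0 = begin
    1                             ≡⟨ g-sum x ux ⟨
    toℕ (g x) + toℕ (g (neg q x)) ≡⟨ cong₂ _+_ (gθ-small a ua 3a<q)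
                                               (g-small (neg q x) u-x 3[-x]<q) ⟩
    0                             ∎

InT-cong : ∀ {q g h} → (∀ {a} → IsUnit q a → IsUnit q (neg q a)) →
           (∀ {a} → IsUnit q a → g a ≡ h a) → InT q g → InT q h
InT-cong {q} {g} {h} neg-unit g≗h (g-sum , g-small) = h-sum , h-small
  where
  h-sum : ∀ a → IsUnit q a → toℕ (h a) + toℕ (h (neg q a)) ≡ 1
  h-sum a ua = trans (cong₂ (λ u v → toℕ u + toℕ v) (sym (g≗h ua)) (sym (g≗h (neg-unit ua))))
                     (g-sum a ua)
  h-small : ∀ a → IsUnit q a → 3 * a < q → toℕ (h a) ≡ 0
  h-small a ua 3a<q = trans (cong toℕ (sym (g≗h ua))) (g-small a ua 3a<q)

upperIndicator : ℕ → ℕ → Fin 2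
upperIndicator h b with b <? h
... | yes _ = zero
... | no  _ = suc zero

upperIndicator-< : ∀ {h b} → b < h → upperIndicator h b ≡ zero
upperIndicator-< {h} {b} b<h with b <? h
... | yes _   = refl
... | no  b≮h = contradiction b<h b≮h

upperIndicator-≥ : ∀ {h b} → h ≤ b → upperIndicator h b ≡ suc zero
upperIndicator-≥ {h} {b} h≤b with b <? h
... | yes b<h = contradiction h≤b (<⇒≱ b<h)
... | no  _   = refl

Obstructed : ℕ → ℕ → Set
Obstructed q s = ∃ λ a → Odd a × 3 * a < q × 2 * q < 3 * θ q s a

module Residues (m : ℕ) (4≤m : 4 ≤ m) where

  16≤4m : 16 ≤ 4 * m
  16≤4m = *-monoʳ-≤ 4 4≤m

  instance
    4m≢0 : NonZero (4 * m)
    4m≢0 = >-nonZero (≤-trans (s≤s z≤n) 16≤4m)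

  2m+6<4m : 2 * m + 6 < 4 * m
  2m+6<4m = begin-strict
    2 * m + 6     <⟨ +-monoʳ-< (2 * m) (≤-trans (≤ᵇ⇒≤ 7 8 _) (*-monoʳ-≤ 2 4≤m)) ⟩
    2 * m + 2 * m ≡⟨ solve (m ∷ []) ⟩
    4 * m         ∎
    where open ≤-Reasoning

  2m<4m : 2 * m < 4 * m
  2m<4m = ≤-<-trans (m≤m+n (2 * m) 6) 2m+6<4m

  2∣2m : 2 ∣ 2 * m
  2∣2m = divides m (*-comm 2 m)

  2∣4m : 2 ∣ 4 * m
  2∣4m = divides (2 * m) (solve (m ∷ []))

  2∣8m : 2 ∣ 8 * m
  2∣8m = divides (4 * m) (solve (m ∷ []))

  obstructed-by : ∀ s {a} k {x} → Odd a → 3 * a < 4 * m →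
                  s * a ≡ k * (4 * m) + x → x < 4 * m → 8 * m < 3 * x → Obstructed (4 * m) s
  obstructed-by s {a} k {x} oa 3a<4m s*a≡ x<4m 8m<3x =
    a , oa , 3a<4m , subst (λ y → 2 * (4 * m) < 3 * y) (sym (θ-≡ {s = s} {a} k s*a≡ x<4m))
                           (subst (_< 3 * x) 8m≡2*4m 8m<3x)
    where
    8m≡2*4m : 8 * m ≡ 2 * (4 * m)
    8m≡2*4m = solve (m ∷ [])

  obstructed-large : ∀ {s} → s < 4 * m → 8 * m < 3 * s → Obstructed (4 * m) s
  obstructed-large {s} s<4m 8m<3s =
    obstructed-by s 0 (0 , refl) (≤-trans (≤ᵇ⇒≤ 4 16 _) 16≤4m) (*-identityʳ s) s<4m 8m<3s

  -- For odd a, (2m + e)·a ≡ 2m + e·a (mod 4m); take the odd a with 2m < 3e·a ≤ 2m + 6e.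
  obstructed-above-half : ∀ e → 1 ≤ e → 3 * (2 * m + e) < 8 * m →
                          Obstructed (4 * m) (2 * m + e)
  obstructed-above-half e 1≤e 3s<8m
    with oddMultipleInWindow (3 * e) (2 * m) (≤-trans 1≤e (m≤n*m e 3))
  ... | k , 2m<3ea , 3ea≤ =
    obstructed-by (2 * m + e) k (k , refl) 3a<4m s*a≡ x<4m 8m<3x
    where
    open ≤-Reasoning
    s*a≡ : (2 * m + e) * (1 + 2 * k) ≡ k * (4 * m) + (2 * m + e * (1 + 2 * k))
    s*a≡ = solve (m ∷ e ∷ k ∷ [])
    3e<2m : 3 * e < 2 * m
    3e<2m = +-cancelˡ-< (6 * m) (3 * e) (2 * m) (begin-strict
      6 * m + 3 * e   ≡⟨ solve (m ∷ e ∷ []) ⟩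
      3 * (2 * m + e) <⟨ 3s<8m ⟩
      8 * m           ≡⟨ solve (m ∷ []) ⟩
      6 * m + 2 * m   ∎)
    ea<2m : e * (1 + 2 * k) < 2 * m
    ea<2m = *-cancelˡ-< 3 (e * (1 + 2 * k)) (2 * m) (begin-strict
      3 * (e * (1 + 2 * k)) ≡⟨ *-assoc 3 e (1 + 2 * k) ⟨
      3 * e * (1 + 2 * k)   ≤⟨ 3ea≤ ⟩
      2 * m + 2 * (3 * e)   <⟨ +-monoʳ-< (2 * m) (*-monoʳ-< 2 3e<2m) ⟩
      2 * m + 2 * (2 * m)   ≡⟨ solve (m ∷ []) ⟩
      3 * (2 * m)           ∎)
    x<4m : 2 * m + e * (1 + 2 * k) < 4 * m
    x<4m = begin-strict
      2 * m + e * (1 + 2 * k) <⟨ +-monoʳ-< (2 * m) ea<2m ⟩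
      2 * m + 2 * m           ≡⟨ solve (m ∷ []) ⟩
      4 * m                   ∎
    8m<3x : 8 * m < 3 * (2 * m + e * (1 + 2 * k))
    8m<3x = begin-strict
      8 * m                         ≡⟨ solve (m ∷ []) ⟩
      6 * m + 2 * m                 <⟨ +-monoʳ-< (6 * m) 2m<3ea ⟩
      6 * m + 3 * e * (1 + 2 * k)   ≡⟨ solve (m ∷ e ∷ k ∷ []) ⟩
      3 * (2 * m + e * (1 + 2 * k)) ∎
    3a<4m : 3 * (1 + 2 * k) < 4 * m
    3a<4m = ≤-<-trans (*-excess-≤ (1 + 2 * k) (*-monoʳ-≤ 3 1≤e) (begin
      3 * e * (1 + 2 * k) ≤⟨ 3ea≤ ⟩
      2 * m + 2 * (3 * e) ≡⟨ cong (2 * m +_) (*-comm 2 (3 * e)) ⟩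
      2 * m + 3 * e * 2   ∎)) 2m+6<4m

  obstructed-by-complement : ∀ s f j x → s + f ≡ 2 * m → f * (1 + 2 * suc j) + x ≡ 6 * m →
                             2 * m < f * (1 + 2 * suc j) → 3 * (f * (1 + 2 * suc j)) < 10 * m →
                             3 * (1 + 2 * suc j) < 4 * m → Obstructed (4 * m) s
  obstructed-by-complement s f j x s+f≡2m fa+x≡6m 2m<fa 3fa<10m 3a<4m =
    obstructed-by s j (suc j , refl) 3a<4m s*a≡ x<4m 8m<3x
    where
    open ≤-Reasoning
    s*a≡ : s * (1 + 2 * suc j) ≡ j * (4 * m) + x
    s*a≡ = +-cancelʳ-≡ (f * (1 + 2 * suc j)) (s * (1 + 2 * suc j)) (j * (4 * m) + x)
                       (begin-equality
      s * (1 + 2 * suc j) + f * (1 + 2 * suc j) ≡⟨ *-distribʳ-+ (1 + 2 * suc j) s f ⟨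
      (s + f) * (1 + 2 * suc j)                 ≡⟨ cong (_* (1 + 2 * suc j)) s+f≡2m ⟩
      2 * m * (1 + 2 * suc j)                   ≡⟨ solve (m ∷ j ∷ []) ⟩
      j * (4 * m) + 6 * m                       ≡⟨ cong (j * (4 * m) +_) fa+x≡6m ⟨
      j * (4 * m) + (f * (1 + 2 * suc j) + x)   ≡⟨ solve (j ∷ m ∷ f ∷ x ∷ []) ⟩
      j * (4 * m) + x + f * (1 + 2 * suc j)     ∎)
    x<4m : x < 4 * m
    x<4m = +-cancelˡ-< (2 * m) x (4 * m) (begin-strict
      2 * m + x               <⟨ +-monoˡ-< x 2m<fa ⟩
      f * (1 + 2 * suc j) + x ≡⟨ fa+x≡6m ⟩
      6 * m                   ≡⟨ solve (m ∷ []) ⟩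
      2 * m + 4 * m           ∎)
    8m<3x : 8 * m < 3 * x
    8m<3x = +-cancelˡ-< (3 * (f * (1 + 2 * suc j))) (8 * m) (3 * x) (begin-strict
      3 * (f * (1 + 2 * suc j)) + 8 * m ≡⟨ +-comm (3 * (f * (1 + 2 * suc j))) (8 * m) ⟩
      8 * m + 3 * (f * (1 + 2 * suc j)) <⟨ +-monoʳ-< (8 * m) 3fa<10m ⟩
      8 * m + 10 * m                    ≡⟨ solve (m ∷ []) ⟩
      3 * (6 * m)                       ≡⟨ cong (3 *_) fa+x≡6m ⟨
      3 * (f * (1 + 2 * suc j) + x)     ≡⟨ *-distribˡ-+ 3 (f * (1 + 2 * suc j)) x ⟩
      3 * (f * (1 + 2 * suc j)) + 3 * x ∎)

  -- For odd a, s·a ≡ 6m − f·a (mod 4m); take the odd a with 6m < 3f·a ≤ 6m + 6f.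
  obstructed-below-half : ∀ s f → 3 ≤ f → s + f ≡ 2 * m → 4 * m < 3 * s →
                          Obstructed (4 * m) s
  obstructed-below-half s f 3≤f s+f≡2m 4m<3s =
    fromWindow (oddMultipleInWindow (3 * f) (6 * m) (≤-trans (s≤s z≤n) (*-monoʳ-≤ 3 3≤f)))
    where
    open ≤-Reasoning
    3f<2m : 3 * f < 2 * m
    3f<2m = +-cancelˡ-< (4 * m) (3 * f) (2 * m) (begin-strict
      4 * m + 3 * f ≡⟨ +-comm (4 * m) (3 * f) ⟩
      3 * f + 4 * m <⟨ +-monoʳ-< (3 * f) 4m<3s ⟩
      3 * f + 3 * s ≡⟨ solve (f ∷ s ∷ []) ⟩
      3 * (s + f)   ≡⟨ cong (3 *_) s+f≡2m ⟩
      3 * (2 * m)   ≡⟨ solve (m ∷ []) ⟩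
      4 * m + 2 * m ∎)
    fromWindow : (∃ λ k → 6 * m < 3 * f * (1 + 2 * k) ×
                          3 * f * (1 + 2 * k) ≤ 6 * m + 2 * (3 * f)) →
                 Obstructed (4 * m) s
    fromWindow (zero , 6m<3f , _) = contradiction 6m<3f (<⇒≯ (begin-strict
      3 * f * 1 ≡⟨ *-identityʳ (3 * f) ⟩
      3 * f     <⟨ 3f<2m ⟩
      2 * m     ≤⟨ *-monoˡ-≤ m (≤ᵇ⇒≤ 2 6 _) ⟩
      6 * m     ∎))
    fromWindow (suc j , 6m<3fa , 3fa≤) =
      obstructed-by-complement s f j (6 * m ∸ f * (1 + 2 * suc j)) s+f≡2m (m+[n∸m]≡n fa≤6m)
                               2m<fa 3fa<10m 3a<4m
      where
      3fa<10m : 3 * (f * (1 + 2 * suc j)) < 10 * m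
      3fa<10m = begin-strict
        3 * (f * (1 + 2 * suc j)) ≡⟨ *-assoc 3 f (1 + 2 * suc j) ⟨
        3 * f * (1 + 2 * suc j)   ≤⟨ 3fa≤ ⟩
        6 * m + 2 * (3 * f)       <⟨ +-monoʳ-< (6 * m) (*-monoʳ-< 2 3f<2m) ⟩
        6 * m + 2 * (2 * m)       ≡⟨ solve (m ∷ []) ⟩
        10 * m                    ∎
      fa≤6m : f * (1 + 2 * suc j) ≤ 6 * m
      fa≤6m = *-cancelˡ-≤ 3 (begin
        3 * (f * (1 + 2 * suc j)) ≤⟨ <⇒≤ 3fa<10m ⟩
        10 * m                    ≤⟨ *-monoˡ-≤ m (≤ᵇ⇒≤ 10 18 _) ⟩
        18 * m                    ≡⟨ solve (m ∷ []) ⟩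
        3 * (6 * m)               ∎)
      2m<fa : 2 * m < f * (1 + 2 * suc j)
      2m<fa = *-cancelˡ-< 3 (2 * m) (f * (1 + 2 * suc j)) (begin-strict
        3 * (2 * m)               ≡⟨ solve (m ∷ []) ⟩
        6 * m                     <⟨ 6m<3fa ⟩
        3 * f * (1 + 2 * suc j)   ≡⟨ *-assoc 3 f (1 + 2 * suc j) ⟩
        3 * (f * (1 + 2 * suc j)) ∎)
      3a<4m : 3 * (1 + 2 * suc j) < 4 * m
      3a<4m = ≤-<-trans (*-cancelˡ-≤ 3 (begin
        3 * (3 * (1 + 2 * suc j)) ≡⟨ *-assoc 3 3 (1 + 2 * suc j) ⟨
        9 * (1 + 2 * suc j)       ≤⟨ *-excess-≤ (1 + 2 * suc j) (*-monoʳ-≤ 3 3≤f)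
                                      (≤-trans 3fa≤ (≤-reflexive (cong (6 * m +_) (*-comm 2 (3 * f))))) ⟩
        6 * m + 9 * 2             ≡⟨ solve (m ∷ []) ⟩
        3 * (2 * m + 6)           ∎)) 2m+6<4m

  -- Take the first odd a with 3s·a > 8m; since 6s ≤ 4m, still s·a ≤ 4m.
  obstructed-small : ∀ {s} → Odd s → 3 ≤ s → 6 * s ≤ 4 * m → Obstructed (4 * m) s
  obstructed-small {s} os 3≤s 6s≤4m
    with oddMultipleInWindow (3 * s) (8 * m) (≤-trans (s≤s z≤n) (*-monoʳ-≤ 3 3≤s))
  ... | k , 8m<3sa , 3sa≤ = obstructed-by s 0 (k , refl) 3a<4m refl sa<4m 8m<3sa'
    where
    open ≤-Reasoning
    sa≤4m : s * (1 + 2 * k) ≤ 4 * m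
    sa≤4m = *-cancelˡ-≤ 3 (begin
      3 * (s * (1 + 2 * k)) ≡⟨ *-assoc 3 s (1 + 2 * k) ⟨
      3 * s * (1 + 2 * k)   ≤⟨ 3sa≤ ⟩
      8 * m + 2 * (3 * s)   ≡⟨ cong (8 * m +_) (solve (s ∷ [])) ⟩
      8 * m + 6 * s         ≤⟨ +-monoʳ-≤ (8 * m) 6s≤4m ⟩
      8 * m + 4 * m         ≡⟨ solve (m ∷ []) ⟩
      3 * (4 * m)           ∎)
    odd<4m : ∀ {x} → Odd x → x ≤ 4 * m → x < 4 * m
    odd<4m ox x≤4m = ≤∧≢⇒< x≤4m (odd≢even ox 2∣4m)
    sa<4m : s * (1 + 2 * k) < 4 * m
    sa<4m = odd<4m (odd*odd os (k , refl)) sa≤4m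
    8m<3sa' : 8 * m < 3 * (s * (1 + 2 * k))
    8m<3sa' = subst (8 * m <_) (*-assoc 3 s (1 + 2 * k)) 8m<3sa
    3a<4m : 3 * (1 + 2 * k) < 4 * m
    3a<4m = odd<4m (odd*odd (1 , refl) (k , refl))
                   (≤-trans (*-monoˡ-≤ (1 + 2 * k) 3≤s) sa≤4m)

  -- 9 is below q/3 only for q > 27; for q = 16 no integer s satisfies both bounds.
  obstructed-by-9 : ∀ {s} → 4 * m < 5 * s → 9 * s < 8 * m → m ≡ 4 ⊎ 8 ≤ m →
                    Obstructed (4 * m) s
  obstructed-by-9 {s} 4m<5s 9s<8m (inj₁ refl) with s ≤? 3
  ... | yes s≤3 = contradiction (≤-trans (*-monoʳ-≤ 5 s≤3) (≤ᵇ⇒≤ 15 16 _)) (<⇒≱ 4m<5s)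
  ... | no  s≰3 = contradiction (≤-trans (≤ᵇ⇒≤ 32 36 _) (*-monoʳ-≤ 9 (≰⇒> s≰3)))
                                (<⇒≱ 9s<8m)
  obstructed-by-9 {s} 4m<5s 9s<8m (inj₂ 8≤m)
    with m≤n⇒∃[o]m+o≡n (<⇒≤ (<-≤-trans 4m<5s (*-monoˡ-≤ s (≤ᵇ⇒≤ 5 9 _))))
  ... | x , 4m+x≡9s =
    obstructed-by s 1 (4 , refl) (≤-trans (≤ᵇ⇒≤ 28 32 _) (*-monoʳ-≤ 4 8≤m)) s*9≡ x<4m 8m<3x
    where
    open ≤-Reasoning
    s*9≡ : s * 9 ≡ 1 * (4 * m) + x
    s*9≡ = begin-equality
      s * 9           ≡⟨ *-comm s 9 ⟩
      9 * s           ≡⟨ 4m+x≡9s ⟨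
      4 * m + x       ≡⟨ cong (_+ x) (*-identityˡ (4 * m)) ⟨
      1 * (4 * m) + x ∎
    x<4m : x < 4 * m
    x<4m = +-cancelˡ-< (4 * m) x (4 * m) (begin-strict
      4 * m + x     ≡⟨ 4m+x≡9s ⟩
      9 * s         <⟨ 9s<8m ⟩
      8 * m         ≡⟨ solve (m ∷ []) ⟩
      4 * m + 4 * m ∎)
    8m<3x : 8 * m < 3 * x
    8m<3x = +-cancelˡ-< (12 * m) (8 * m) (3 * x) (begin-strict
      12 * m + 8 * m  ≡⟨ solve (m ∷ []) ⟩
      5 * (4 * m)     <⟨ *-monoʳ-< 5 4m<5s ⟩
      5 * (5 * s)     ≡⟨ solve (s ∷ []) ⟩
      25 * s          ≤⟨ *-monoˡ-≤ s (≤ᵇ⇒≤ 25 27 _) ⟩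
      27 * s          ≡⟨ solve (s ∷ []) ⟩
      3 * (9 * s)     ≡⟨ cong (3 *_) 4m+x≡9s ⟨
      3 * (4 * m + x) ≡⟨ solve (m ∷ x ∷ []) ⟩
      12 * m + 3 * x  ∎)

  obstructed-medium : ∀ {s} → Odd s → 4 * m < 6 * s → 3 * s < 4 * m → m ≡ 4 ⊎ 8 ≤ m →
                      Obstructed (4 * m) s
  obstructed-medium {s} os 4m<6s 3s<4m m≡4⊎8≤m with <-cmp (8 * m) (9 * s)
  ... | tri< 8m<9s _ _ =
    obstructed-by s 0 (1 , refl) (≤-trans (≤ᵇ⇒≤ 10 16 _) 16≤4m) (*-comm s 3) 3s<4m
      (subst (8 * m <_) (*-assoc 3 3 s) 8m<9s)
  ... | tri≈ _ 8m≡9s _ = contradiction (sym 8m≡9s) (odd≢even (odd*odd (4 , refl) os) 2∣8m)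
  ... | tri> _ _ 9s<8m with <-cmp (5 * s) (4 * m)
  ...   | tri< 5s<4m _ _ =
    obstructed-by s 0 (2 , refl) 16≤4m (*-comm s 5) 5s<4m (begin-strict
      8 * m       ≡⟨ solve (m ∷ []) ⟩
      2 * (4 * m) <⟨ *-monoʳ-< 2 4m<6s ⟩
      2 * (6 * s) ≡⟨ solve (s ∷ []) ⟩
      12 * s      ≤⟨ *-monoˡ-≤ s (≤ᵇ⇒≤ 12 15 _) ⟩
      15 * s      ≡⟨ solve (s ∷ []) ⟩
      3 * (5 * s) ∎)
    where open ≤-Reasoning
  ...   | tri≈ _ 5s≡4m _ = contradiction 5s≡4m (odd≢even (odd*odd (2 , refl) os) 2∣4m)
  ...   | tri> _ _ 4m<5s = obstructed-by-9 {s} 4m<5s 9s<8m m≡4⊎8≤m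

  obstructed-middle : ∀ {s} → Odd s → s ≢ 2 * m ∸ 1 → 4 * m < 3 * s → 3 * s < 8 * m →
                      Obstructed (4 * m) s
  obstructed-middle {s} os s≢2m-1 4m<3s 3s<8m with <-cmp (2 * m) s
  ... | tri< 2m<s _ _ with m≤n⇒∃[o]m+o≡n 2m<s
  ...   | e , 2m+1+e≡s =
    subst (Obstructed (4 * m)) 2m+e+1≡s
      (obstructed-above-half (suc e) (s≤s z≤n)
        (subst (λ z → 3 * z < 8 * m) (sym 2m+e+1≡s) 3s<8m))
    where
    2m+e+1≡s : 2 * m + suc e ≡ s
    2m+e+1≡s = trans (+-suc (2 * m) e) 2m+1+e≡s
  obstructed-middle os _ _ _ | tri≈ _ 2m≡s _ = contradiction (sym 2m≡s) (odd≢even os 2∣2m)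
  obstructed-middle {s} os s≢2m-1 4m<3s _ | tri> _ _ s<2m with m≤n⇒∃[o]m+o≡n s<2m
  ... | 0 , s+1≡2m = contradiction (trans (sym (+-identityʳ s)) (cong (_∸ 1) s+1≡2m)) s≢2m-1
  ... | 1 , s+2≡2m = contradiction (trans (+-suc s 1) s+2≡2m) (odd≢even (odd+2 os) 2∣2m)
  ... | suc (suc f) , s+3+f≡2m =
    obstructed-below-half s (3 + f) (s≤s (s≤s (s≤s z≤n)))
      (trans (+-suc s (2 + f)) s+3+f≡2m) 4m<3s

  obstructed : ∀ {s} → Odd s → s < 4 * m → s ≢ 1 → s ≢ 2 * m ∸ 1 → m ≡ 4 ⊎ 8 ≤ m →
               Obstructed (4 * m) s
  obstructed {s} os s<4m s≢1 s≢2m-1 m≡4⊎8≤m with <-cmp (8 * m) (3 * s)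
  ... | tri< 8m<3s _ _ = obstructed-large s<4m 8m<3s
  ... | tri≈ _ 8m≡3s _ = contradiction (sym 8m≡3s) (odd≢even (odd*odd (1 , refl) os) 2∣8m)
  ... | tri> _ _ 3s<8m with <-cmp (4 * m) (3 * s)
  ...   | tri< 4m<3s _ _ = obstructed-middle os s≢2m-1 4m<3s 3s<8m
  ...   | tri≈ _ 4m≡3s _ = contradiction (sym 4m≡3s) (odd≢even (odd*odd (1 , refl) os) 2∣4m)
  ...   | tri> _ _ 3s<4m with 6 * s ≤? 4 * m
  ...     | yes 6s≤4m = obstructed-small os (odd∧≢1⇒3≤ os s≢1) 6s≤4m
  ...     | no  6s≰4m = obstructed-medium os (≰⇒> 6s≰4m) 3s<4m m≡4⊎8≤m

  module _ {s : ℕ} (s+1≡2m : s + 1 ≡ 2 * m) where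

    θ-lower : ∀ {b} → Odd b → b < 2 * m → θ (4 * m) s b + b ≡ 2 * m
    θ-lower {b} (k , refl) b<2m with m≤n⇒∃[o]m+o≡n (<⇒≤ b<2m)
    ... | x , b+x≡2m = begin-equality
      θ (4 * m) s b + b ≡⟨ cong (_+ b) (θ-≡ {s = s} {b} k s*b≡ x<4m) ⟩
      x + b             ≡⟨ +-comm x b ⟩
      b + x             ≡⟨ b+x≡2m ⟩
      2 * m             ∎
      where
      open ≤-Reasoning
      s*b≡ : s * (1 + 2 * k) ≡ k * (4 * m) + x
      s*b≡ = +-cancelʳ-≡ (1 + 2 * k) (s * (1 + 2 * k)) (k * (4 * m) + x) (begin-equality
        s * (1 + 2 * k) + (1 + 2 * k) ≡⟨ solve (s ∷ k ∷ []) ⟩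
        (s + 1) * (1 + 2 * k)         ≡⟨ cong (_* (1 + 2 * k)) s+1≡2m ⟩
        2 * m * (1 + 2 * k)           ≡⟨ solve (m ∷ k ∷ []) ⟩
        k * (4 * m) + 2 * m           ≡⟨ cong (k * (4 * m) +_) b+x≡2m ⟨
        k * (4 * m) + (1 + 2 * k + x) ≡⟨ solve (m ∷ k ∷ x ∷ []) ⟩
        k * (4 * m) + x + (1 + 2 * k) ∎)
      x<4m : x < 4 * m
      x<4m = ≤-<-trans (≤-trans (m≤n+m x (1 + 2 * k)) (≤-reflexive b+x≡2m)) 2m<4m

    θ-upper : ∀ {b} → Odd b → 2 * m < b → b < 4 * m → θ (4 * m) s b + b ≡ 6 * m
    θ-upper (zero , refl) 2m<1 _ =
      contradiction (≤-trans (≤ᵇ⇒≤ 1 8 _) (*-monoʳ-≤ 2 4≤m)) (<⇒≱ 2m<1)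
    θ-upper {b} (suc j , refl) 2m<b b<4m
      with m≤n⇒∃[o]m+o≡n (≤-trans (<⇒≤ b<4m) (*-monoˡ-≤ m (≤ᵇ⇒≤ 4 6 _)))
    ... | x , b+x≡6m = begin-equality
      θ (4 * m) s b + b ≡⟨ cong (_+ b) (θ-≡ {s = s} {b} j s*b≡ x<4m) ⟩
      x + b             ≡⟨ +-comm x b ⟩
      b + x             ≡⟨ b+x≡6m ⟩
      6 * m             ∎
      where
      open ≤-Reasoning
      s*b≡ : s * (1 + 2 * suc j) ≡ j * (4 * m) + x
      s*b≡ = +-cancelʳ-≡ (1 + 2 * suc j) (s * (1 + 2 * suc j)) (j * (4 * m) + x) (begin-equality
        s * (1 + 2 * suc j) + (1 + 2 * suc j) ≡⟨ solve (s ∷ j ∷ []) ⟩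
        (s + 1) * (1 + 2 * suc j)             ≡⟨ cong (_* (1 + 2 * suc j)) s+1≡2m ⟩
        2 * m * (1 + 2 * suc j)               ≡⟨ solve (m ∷ j ∷ []) ⟩
        j * (4 * m) + 6 * m                   ≡⟨ cong (j * (4 * m) +_) b+x≡6m ⟨
        j * (4 * m) + (1 + 2 * suc j + x)     ≡⟨ solve (m ∷ j ∷ x ∷ []) ⟩
        j * (4 * m) + x + (1 + 2 * suc j)     ∎)
      x<4m : x < 4 * m
      x<4m = +-cancelˡ-< (2 * m) x (4 * m) (begin-strict
        2 * m + x     <⟨ +-monoˡ-< x 2m<b ⟩
        b + x         ≡⟨ b+x≡6m ⟩
        6 * m         ≡⟨ solve (m ∷ []) ⟩
        2 * m + 4 * m ∎)

module Characterisation (m : ℕ) (4≤m : 4 ≤ m) (m≡4⊎8≤m : m ≡ 4 ⊎ 8 ≤ m)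
                        (odd⇒coprime : ∀ {a} → Odd a → Coprime a (4 * m)) where

  open Residues m 4≤m

  unit⇒odd : ∀ {a} → IsUnit (4 * m) a → Odd a
  unit⇒odd {a} (_ , a⊥4m) = coprime-2*⇒odd (2 * m) (subst (Coprime a) 4m≡2*2m a⊥4m)
    where
    4m≡2*2m : 4 * m ≡ 2 * (2 * m)
    4m≡2*2m = solve (m ∷ [])

  odd⇒unit : ∀ {a} → Odd a → a < 4 * m → IsUnit (4 * m) a
  odd⇒unit oa a<4m = a<4m , odd⇒coprime oa

  neg-unit : ∀ {a} → IsUnit (4 * m) a → IsUnit (4 * m) (neg (4 * m) a)
  neg-unit {a} ua@(a<4m , _) =
    odd⇒unit (even-odd⇒odd 2∣4m (unit⇒odd ua) -a+a≡4m)
             (subst (neg (4 * m) a <_) -a+a≡4m (m<m+n _ (odd⇒0< (unit⇒odd ua))))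
    where
    -a+a≡4m : neg (4 * m) a + a ≡ 4 * m
    -a+a≡4m = neg-+ (odd⇒0< (unit⇒odd ua)) (<⇒≤ a<4m)

  θ-unit : ∀ {s a} → Odd s → Odd a → IsUnit (4 * m) (θ (4 * m) s a)
  θ-unit {s} {a} os oa = odd⇒unit odd-θ θ<4m
    where
    θ<4m : θ (4 * m) s a < 4 * m
    θ<4m = subst (_< 4 * m) (sym (mod≡% (s * a) (4 * m))) (m%n<n (s * a) (4 * m))
    odd-θ : Odd (θ (4 * m) s a)
    odd-θ = odd+even⇒odd (∣-trans 2∣4m (n∣m*n (s * a / (4 * m))))
                         (subst Odd (sym (θ-+-multiple (4 * m) s a)) (odd*odd os oa))

  InS⇒≡ : ∀ {s} → InS (4 * m) s → s ≡ 2 * m ∸ 1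
  InS⇒≡ {s} (us@(s<4m , _) , s≢1 , g , Tg , Tgθ) with s ≟ 2 * m ∸ 1
  ... | yes s≡2m-1 = s≡2m-1
  ... | no  s≢2m-1 with obstructed (unit⇒odd us) s<4m s≢1 s≢2m-1 m≡4⊎8≤m
  ...   | a , oa , 3a<4m , 8m<3x =
    ⊥-elim (crossing⇒⊥ {s = s} {g} Tg Tgθ ua 3a<4m ux (neg-unit ux) 3[-x]<4m)
    where
    x = θ (4 * m) s a
    ua : IsUnit (4 * m) a
    ua = odd⇒unit oa (≤-<-trans (m≤n*m a 3) 3a<4m)
    ux : IsUnit (4 * m) x
    ux = θ-unit (unit⇒odd us) oa
    3[-x]<4m : 3 * neg (4 * m) x < 4 * m
    3[-x]<4m = complement-small {x} {neg (4 * m) x}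
                 (neg-+ {4 * m} {x} (odd⇒0< (unit⇒odd ux)) (<⇒≤ (proj₁ ux))) 8m<3x

  neg+≡2m+2m : ∀ {a} → IsUnit (4 * m) a → neg (4 * m) a + a ≡ 2 * m + 2 * m
  neg+≡2m+2m ua@(a<4m , _) = trans (neg-+ (odd⇒0< (unit⇒odd ua)) (<⇒≤ a<4m)) (solve (m ∷ []))

  upperIndicator-InT : InT (4 * m) (upperIndicator (2 * m))
  upperIndicator-InT = sum , small
    where
    sum : ∀ a → IsUnit (4 * m) a →
          toℕ (upperIndicator (2 * m) a) + toℕ (upperIndicator (2 * m) (neg (4 * m) a)) ≡ 1
    sum a ua with <-cmp a (2 * m)
    ... | tri< a<2m _ _ = cong₂ (λ u v → toℕ u + toℕ v) (upperIndicator-< a<2m)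
                            (upperIndicator-≥ (<⇒≤ (complement-< (neg+≡2m+2m ua) a<2m)))
    ... | tri≈ _ a≡2m _ = contradiction a≡2m (odd≢even (unit⇒odd ua) 2∣2m)
    ... | tri> _ _ 2m<a = cong₂ (λ u v → toℕ u + toℕ v) (upperIndicator-≥ (<⇒≤ 2m<a))
                            (upperIndicator-< (complement-> (neg+≡2m+2m ua) 2m<a))
    small : ∀ a → IsUnit (4 * m) a → 3 * a < 4 * m → toℕ (upperIndicator (2 * m) a) ≡ 0
    small a _ 3a<4m = cong toℕ (upperIndicator-< (*-cancelˡ-< 3 a (2 * m) (begin-strict
      3 * a       <⟨ 3a<4m ⟩
      4 * m       ≤⟨ *-monoˡ-≤ m (≤ᵇ⇒≤ 4 6 _) ⟩
      6 * m       ≡⟨ solve (m ∷ []) ⟩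
      3 * (2 * m) ∎)))
      where open ≤-Reasoning

  upperIndicator-θ : ∀ {s b} → s + 1 ≡ 2 * m → IsUnit (4 * m) b →
                     upperIndicator (2 * m) b ≡ upperIndicator (2 * m) (θ (4 * m) s b)
  upperIndicator-θ {s} {b} s+1≡2m ub with <-cmp b (2 * m)
  ... | tri< b<2m _ _ = trans (upperIndicator-< b<2m) (sym (upperIndicator-<
          (subst (θ (4 * m) s b <_) (θ-lower s+1≡2m ob b<2m) (m<m+n _ (odd⇒0< ob)))))
    where ob = unit⇒odd ub
  ... | tri≈ _ b≡2m _ = contradiction b≡2m (odd≢even (unit⇒odd ub) 2∣2m)
  ... | tri> _ _ 2m<b =
    trans (upperIndicator-≥ (<⇒≤ 2m<b)) (sym (upperIndicator-≥ (<⇒≤ 2m<θb)))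
    where
    open ≤-Reasoning
    b<4m = proj₁ ub
    2m<θb : 2 * m < θ (4 * m) s b
    2m<θb = +-cancelʳ-< b (2 * m) (θ (4 * m) s b) (begin-strict
      2 * m + b         <⟨ +-monoʳ-< (2 * m) b<4m ⟩
      2 * m + 4 * m     ≡⟨ solve (m ∷ []) ⟩
      6 * m             ≡⟨ θ-upper s+1≡2m (unit⇒odd ub) 2m<b b<4m ⟨
      θ (4 * m) s b + b ∎)

  ≡⇒InS : ∀ {s} → s ≡ 2 * m ∸ 1 → InS (4 * m) s
  ≡⇒InS {s} refl = odd⇒unit os s<4m , s≢1 , upperIndicator (2 * m) , upperIndicator-InT ,
                   InT-cong neg-unit (upperIndicator-θ s+1≡2m) upperIndicator-InT
    where
    s+1≡2m : 2 * m ∸ 1 + 1 ≡ 2 * m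
    s+1≡2m = m∸n+n≡m (≤-trans (s≤s z≤n) (≤-trans 4≤m (m≤n*m m 2)))
    os : Odd (2 * m ∸ 1)
    os = even-odd⇒odd 2∣2m (0 , refl) s+1≡2m
    s<4m : 2 * m ∸ 1 < 4 * m
    s<4m = ≤-<-trans (m∸n≤m (2 * m) 1) 2m<4m
    s≢1 : 2 * m ∸ 1 ≢ 1
    s≢1 s≡1 = contradiction (trans (sym s+1≡2m) (cong (_+ 1) s≡1))
                            (≢-sym (<⇒≢ (≤-trans (≤ᵇ⇒≤ 3 8 _) (*-monoʳ-≤ 2 4≤m))))

  InS⇔ : ∀ s → InS (4 * m) s ⇔ (s ≡ 2 * m ∸ 1)
  InS⇔ s = mk⇔ InS⇒≡ ≡⇒InS

2^t≡4⊎8≤2^t : ∀ t → 4 ≤ 2 ^ t → 2 ^ t ≡ 4 ⊎ 8 ≤ 2 ^ t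
2^t≡4⊎8≤2^t 0 (s≤s ())
2^t≡4⊎8≤2^t 1 (s≤s (s≤s ()))
2^t≡4⊎8≤2^t 2 _ = inj₁ refl
2^t≡4⊎8≤2^t (suc (suc (suc t))) _ =
  inj₂ (*-monoʳ-≤ 2 (*-monoʳ-≤ 2 (*-monoʳ-≤ 2 (m^n>0 2 t))))

lemma5p19 : (r : ℕ) → 16 ≤ 2 ^ r → (s : ℕ) → s < 2 ^ r →
            InS (2 ^ r) s ⇔ (s ≡ (2 ^ r) / 2 ∸ 1)
lemma5p19 0 (s≤s ())
lemma5p19 1 (s≤s (s≤s ()))
lemma5p19 (suc (suc t)) 16≤q s _ =
  subst₂ (λ q h → InS q s ⇔ (s ≡ h ∸ 1)) (sym q≡4m) (sym q/2≡2m)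
         (Characterisation.InS⇔ m 4≤m (2^t≡4⊎8≤2^t t 4≤m) odd⇒coprime s)
  where
  m = 2 ^ t
  q≡4m : 2 * (2 * m) ≡ 4 * m
  q≡4m = sym (*-assoc 2 2 m)
  q/2≡2m : 2 * (2 * m) / 2 ≡ 2 * m
  q/2≡2m = trans (cong (_/ 2) (*-comm 2 (2 * m))) (m*n/n≡m (2 * m) 2)
  4≤m : 4 ≤ m
  4≤m = *-cancelˡ-≤ 4 (subst (16 ≤_) q≡4m 16≤q)
  odd⇒coprime : ∀ {a} → Odd a → Coprime a (4 * m)
  odd⇒coprime {a} oa = subst (Coprime a) q≡4m (odd⇒coprime-2^ oa (2 + t))
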